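{- Let $X$ be a finite set with $|X|\geqslant 4$. Let $\alpha\in\mathcal{T}(X)\setminus\mathcal{S}(X)$ and $\beta\in\mathcal{P}(X)\setminus(\mathcal{T}(X)\cup\{\emptyset\})$. Then the distance between $\alpha$ and $\beta$ in the commuting graph $\mathcal{G}(\mathcal{P}(X))$ is at most $4$.
   Context: $\mathcal{P}(X)$ is the partial transformation semigroup on $X$: all functions whose domain and image are subsets of $X$ (including the empty map $\emptyset$), with composition of functions as multiplication (maps act on the right, $x(\alpha\beta)=(x\alpha)\beta$). $\mathcal{T}(X)$ is the set of full transformations (maps with domain $X$) and $\mathcal{S}(X)$ the set of permutations of $X$. The center of $\mathcal{P}(X)$ is $\{\emptyset,\mathrm{id}_X\}$. For a finite non-commutative semigroup $S$, the commuting graph $\mathcal{G}(S)$ is the simple graph with vertex set $S\setminus Z(S)$ ($Z(S)$ the center), two distinct vertices $x,y$ being adjacent iff $xy=yx$. The distance between two vertices is the length of a shortest path between them ($\infty$ if none). -}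

module Defs where

open import Data.Nat using (ℕ; zero; suc; _≤_)
open import Data.Fin using (Fin)
open import Data.Maybe using (Maybe; just; nothing; _>>=_)
open import Data.Product using (Σ; ∃; _×_; _,_)
open import Relation.Binary.PropositionalEquality using (_≡_)
open import Relation.Nullary using (¬_)

-- The finite set X is modelled as Fin n (|X| = n).
-- A partial transformation of X: an element of P(X).
PT : ℕ → Set
PT n = Fin n → Maybe (Fin n)

_≈_ : ∀ {n} → PT n → PT n → Set
α ≈ β = ∀ x → α x ≡ β x

-- Composition, maps acting on the right: x(αβ) = (xα)β.
_·_ : ∀ {n} → PT n → PT n → PT n
(α · β) x = α x >>= β

emptyMap : ∀ {n} → PT n
emptyMap _ = nothing

idMap : ∀ {n} → PT n
idMap x = just x

IsFull : ∀ {n} → PT n → Set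
IsFull {n} α = ∀ x → ∃ λ y → α x ≡ just y

IsPerm : ∀ {n} → PT n → Set
IsPerm {n} α = IsFull α
             × (∀ x y → α x ≡ α y → x ≡ y)
             × (∀ y → ∃ λ x → α x ≡ just y)

-- Vertices of G(P(X)): elements outside the center Z(P(X)) = {∅, id_X}.
IsVertex : ∀ {n} → PT n → Set
IsVertex α = ¬ (α ≈ emptyMap) × ¬ (α ≈ idMap)

Adjacent : ∀ {n} → PT n → PT n → Set
Adjacent α β = IsVertex α × IsVertex β × ¬ (α ≈ β) × ((α · β) ≈ (β · α))

data Path {n : ℕ} : ℕ → PT n → PT n → Set where
  here  : ∀ {α} → IsVertex α → Path zero α α
  step  : ∀ {k α γ β} → Adjacent α γ → Path k γ β → Path (suc k) α β

DistLE : ∀ {n} → PT n → PT n → ℕ → Set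
DistLE α β d = ∃ λ k → k ≤ d × Path k α β

-- Pick q outside the domain of β and p outside its image (β is not onto, since it is
-- not full and X is finite). The partial map ν = [p ↦ q] commutes with β because
-- νβ = βν = ∅, so it suffices to join α to ν by three commuting steps; a walk of
-- commuting vertices shortens to a path by dropping repetitions. If α fixes a point f,
-- take α — κ — σ — ν with κ the constant map onto f and σ the map sending a fresh
-- point u to a fresh point t and fixing everything else. Otherwise take
-- α — ε — ℓ — ν, where ε = α^{n!} is idempotent and not the identity (α is not a
-- permutation); ε q and α(ε q) are distinct fixed points of ε, so ε has a fixed point
-- w ≠ p, and ℓ sends the fibre of ε over α(ε q) to w and is undefined elsewhere.

module Submission where

open import Defs
open import Data.Fin using (Fin; toℕ; _≟_; punchOut)
import Data.Fin.Properties as Fin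
open import Data.List using (List; []; _∷_; length)
open import Data.List.Membership.Propositional using (_∈_; _∉_)
import Data.List.Membership.DecPropositional as DecMembership
import Data.List.Membership.Setoid.Properties as Membership
open import Data.List.Relation.Unary.Any using (here; there)
open import Data.Maybe using (just; nothing; _>>=_)
import Data.Maybe.Properties as Maybe
open import Data.Nat using (ℕ; zero; suc; _+_; _*_; _∸_; _≤_; _<_; _!; NonZero; >-nonZero; z≤n; s≤s)
open import Data.Nat.Divisibility using (_∣_; divides; ∣-trans; m∣m*n; m≤n⇒m!∣n!; ∣⇒≤)
import Data.Nat.Properties as ℕ
open import Data.Product using (∃; ∃₂; _×_; _,_; proj₁; proj₂)
open import Data.Sum using (_⊎_; inj₁; inj₂)
open import Function using (_∘_; const)
import Function.Endo.Propositional as Endo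
open import Relation.Binary.PropositionalEquality
open import Relation.Nullary using (¬_; Dec; yes; no; contradiction)

m≤n⇒m∣n! : ∀ {m n} .{{_ : NonZero m}} → m ≤ n → m ∣ n !
m≤n⇒m∣n! {suc m} m≤n = ∣-trans (m∣m*n (m !)) (m≤n⇒m!∣n! m≤n)

module _ {A : Set} where
  open Endo A using (_^_; ^-homo)

  module _ (f : A → A) where

    ^-+ : ∀ i j x → (f ^ (i + j)) x ≡ (f ^ i) ((f ^ j) x)
    ^-+ i j x = cong-app (^-homo f i j) x

    ^-* : ∀ i j x → (f ^ (i * j)) x ≡ ((f ^ j) ^ i) x
    ^-* zero j x = refl
    ^-* (suc i) j x = trans (^-+ j (i * j) x) (cong (f ^ j) (^-* i j x))

    ^-commute : ∀ i j x → (f ^ i) ((f ^ j) x) ≡ (f ^ j) ((f ^ i) x)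
    ^-commute i j x = begin
      (f ^ i) ((f ^ j) x) ≡⟨ ^-+ i j x ⟨
      (f ^ (i + j)) x     ≡⟨ cong (λ k → (f ^ k) x) (ℕ.+-comm i j) ⟩
      (f ^ (j + i)) x     ≡⟨ ^-+ j i x ⟩
      (f ^ j) ((f ^ i) x) ∎
      where open ≡-Reasoning

  ^-fixed : ∀ (f : A → A) {x} → f x ≡ x → ∀ i → (f ^ i) x ≡ x
  ^-fixed f fx≡x zero = refl
  ^-fixed f fx≡x (suc i) = trans (cong f (^-fixed f fx≡x i)) fx≡x

  ^-periodic : ∀ (f : A → A) {x d k} → (f ^ d) x ≡ x → d ∣ k → (f ^ k) x ≡ x
  ^-periodic f {x} {d} fᵈx≡x (divides c refl) = trans (^-* f c d x) (^-fixed (f ^ d) fᵈx≡x c)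

module _ {n : ℕ} where
  open Endo (Fin n) using (_^_)

  orbit-repeats : (f : Fin n → Fin n) → ∀ x → ∃₂ λ a b → a < b × b ≤ n × (f ^ a) x ≡ (f ^ b) x
  orbit-repeats f x with Fin.pigeonhole (ℕ.n<1+n n) (λ i → (f ^ toℕ i) x)
  ... | i , j , i<j , fⁱx≡fʲx = toℕ i , toℕ j , i<j , ℕ.≤-pred (Fin.toℕ<n j) , fⁱx≡fʲx

  -- The orbit of x enters a cycle after a ≤ n steps, and the cycle length d ≤ n divides n!.
  ^!-idempotent : (f : Fin n → Fin n) → ∀ x → (f ^ (n !)) ((f ^ (n !)) x) ≡ (f ^ (n !)) x
  ^!-idempotent f x with orbit-repeats f x
  ... | a , b , a<b , b≤n , fᵃx≡fᵇx = ^-periodic f fᵈz≡z (m≤n⇒m∣n! {{>-nonZero (ℕ.m<n⇒0<n∸m a<b)}} d≤n)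
    where
    d s : ℕ
    d = b ∸ a
    s = n ! ∸ a
    y z : Fin n
    y = (f ^ a) x
    z = (f ^ (n !)) x
    d≤n : d ≤ n
    d≤n = ℕ.≤-trans (ℕ.m∸n≤m b a) b≤n
    a≤n! : a ≤ n !
    a≤n! = ℕ.≤-trans (ℕ.<⇒≤ a<b) (∣⇒≤ {{n ℕ.!≢0}} (m≤n⇒m∣n! {{>-nonZero (ℕ.≤-trans (s≤s z≤n) a<b)}} b≤n))
    fᵈy≡y : (f ^ d) y ≡ y
    fᵈy≡y = begin
      (f ^ d) y       ≡⟨ ^-+ f d a x ⟨
      (f ^ (d + a)) x ≡⟨ cong (λ k → (f ^ k) x) (ℕ.m∸n+n≡m (ℕ.<⇒≤ a<b)) ⟩
      (f ^ b) x       ≡⟨ fᵃx≡fᵇx ⟨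
      y               ∎
      where open ≡-Reasoning
    z≡fˢy : z ≡ (f ^ s) y
    z≡fˢy = trans (cong (λ k → (f ^ k) x) (sym (ℕ.m∸n+n≡m a≤n!))) (^-+ f s a x)
    fᵈz≡z : (f ^ d) z ≡ z
    fᵈz≡z = begin
      (f ^ d) z           ≡⟨ cong (f ^ d) z≡fˢy ⟩
      (f ^ d) ((f ^ s) y) ≡⟨ ^-commute f d s y ⟩
      (f ^ s) ((f ^ d) y) ≡⟨ cong (f ^ s) fᵈy≡y ⟩
      (f ^ s) y           ≡⟨ z≡fˢy ⟨
      z                   ∎
      where open ≡-Reasoning

fresh : ∀ {n} (xs : List (Fin n)) → length xs < n → ∃ λ u → u ∉ xs
fresh {n} xs |xs|<n = Fin.¬∀⟶∃¬ n (_∈ xs) (_∈? xs) λ all∈ →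
  ℕ.<⇒≱ |xs|<n (Fin.injective⇒≤ (Membership.index-injective (setoid (Fin n)) (all∈ _) (all∈ _)))
  where open DecMembership (_≟_ {n}) using (_∈?_)

fresh₃ : ∀ {n} → 4 ≤ n → (a b c : Fin n) → ∃ λ u → u ≢ a × u ≢ b × u ≢ c
fresh₃ 4≤n a b c with fresh (a ∷ b ∷ c ∷ []) 4≤n
... | u , u∉ = u , u∉ ∘ here , u∉ ∘ there ∘ here , u∉ ∘ there ∘ there ∘ here

module _ {n : ℕ} where

  ≈-refl : {a : PT n} → a ≈ a
  ≈-refl _ = refl

  ≈-sym : {a b : PT n} → a ≈ b → b ≈ a
  ≈-sym a≈b x = sym (a≈b x)

  ≈-trans : {a b c : PT n} → a ≈ b → b ≈ c → a ≈ c
  ≈-trans a≈b b≈c x = trans (a≈b x) (b≈c x)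

  _≈?_ : (a b : PT n) → Dec (a ≈ b)
  a ≈? b = Fin.all? (λ x → Maybe.≡-dec _≟_ (a x) (b x))

  ·-congˡ : {a b b′ : PT n} → b ≈ b′ → (a · b) ≈ (a · b′)
  ·-congˡ {a} b≈b′ x with a x
  ... | nothing = refl
  ... | just y = b≈b′ y

  ·-congʳ : {a a′ b : PT n} → a ≈ a′ → (a · b) ≈ (a′ · b)
  ·-congʳ {b = b} a≈a′ x = cong (_>>= b) (a≈a′ x)

  Commute : PT n → PT n → Set
  Commute a b = (a · b) ≈ (b · a)

  Commute-sym : {a b : PT n} → Commute a b → Commute b a
  Commute-sym = ≈-sym

  Commute-respˡ : {a a′ b : PT n} → a ≈ a′ → Commute a b → Commute a′ b
  Commute-respˡ {a} {a′} {b} a≈a′ ab =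
    ≈-trans (·-congʳ {b = b} (≈-sym a≈a′)) (≈-trans ab (·-congˡ {a = b} a≈a′))

  Commute-respʳ : {a b b′ : PT n} → b ≈ b′ → Commute a b → Commute a b′
  Commute-respʳ {a} b≈b′ = Commute-sym {a = _} {b = a} ∘ Commute-respˡ b≈b′ ∘ Commute-sym {a = a}

  annihilating⇒Commute : {a b : PT n} → (a · b) ≈ emptyMap → (b · a) ≈ emptyMap → Commute a b
  annihilating⇒Commute ab≈∅ ba≈∅ = ≈-trans ab≈∅ (≈-sym ba≈∅)

  IsVertex-resp : {a a′ : PT n} → a ≈ a′ → IsVertex a → IsVertex a′
  IsVertex-resp a≈a′ (a≉∅ , a≉id) = a≉∅ ∘ ≈-trans a≈a′ , a≉id ∘ ≈-trans a≈a′

  Adjacent-respˡ : {a a′ b : PT n} → a ≈ a′ → Adjacent a b → Adjacent a′ b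
  Adjacent-respˡ a≈a′ (aᵥ , bᵥ , a≉b , ab) =
    IsVertex-resp a≈a′ aᵥ , bᵥ , a≉b ∘ ≈-trans a≈a′ , Commute-respˡ a≈a′ ab

  defined⇒≉∅ : {a : PT n} {x y : Fin n} → a x ≡ just y → ¬ a ≈ emptyMap
  defined⇒≉∅ {x = x} ax≡y a≈∅ with () ← trans (sym ax≡y) (a≈∅ x)

  partial⇒IsVertex : {a : PT n} {x y x′ : Fin n} → a x ≡ just y → a x′ ≡ nothing → IsVertex a
  partial⇒IsVertex {x′ = x′} ax≡y ax′≡∅ = defined⇒≉∅ ax≡y , a≉id
    where
    a≉id : ¬ _ ≈ idMap
    a≉id a≈id with () ← trans (sym ax′≡∅) (a≈id x′)

  moves⇒IsVertex : {a : PT n} {x y : Fin n} → a x ≡ just y → x ≢ y → IsVertex a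
  moves⇒IsVertex {x = x} ax≡y x≢y =
    defined⇒≉∅ ax≡y , λ a≈id → x≢y (Maybe.just-injective (trans (sym (a≈id x)) ax≡y))

  ≈id⇒IsPerm : {a : PT n} → a ≈ idMap → IsPerm a
  ≈id⇒IsPerm a≈id = (λ x → x , a≈id x) ,
    (λ x y ax≡ay → Maybe.just-injective (trans (sym (a≈id x)) (trans ax≡ay (a≈id y)))) ,
    (λ y → y , a≈id y)

  full⇒IsVertex : {a : PT n} → Fin n → IsFull a → ¬ IsPerm a → IsVertex a
  full⇒IsVertex x a-full a-nonPerm = defined⇒≉∅ (proj₂ (a-full x)) , a-nonPerm ∘ ≈id⇒IsPerm

  nonFull⇒IsVertex : {a : PT n} → ¬ a ≈ emptyMap → ¬ IsFull a → IsVertex a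
  nonFull⇒IsVertex a≉∅ a-partial = a≉∅ , λ a≈id → a-partial (proj₁ (≈id⇒IsPerm a≈id))

  infixr 5 _∷⟨_⟩_

  -- Unlike a Path, consecutive vertices may coincide.
  data CommWalk : ℕ → PT n → PT n → Set where
    [_]    : ∀ {a} → IsVertex a → CommWalk 0 a a
    _∷⟨_⟩_ : ∀ {k a b c} → IsVertex a → Commute a b → CommWalk k b c → CommWalk (suc k) a c

  walk-head : ∀ {k a c} → CommWalk k a c → IsVertex a
  walk-head [ aᵥ ] = aᵥ
  walk-head (aᵥ ∷⟨ _ ⟩ _) = aᵥ

  walk-last : ∀ {k a c} → CommWalk k a c → IsVertex c
  walk-last [ cᵥ ] = cᵥ
  walk-last (_ ∷⟨ _ ⟩ w) = walk-last w

  Reaches : ℕ → PT n → PT n → Set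
  Reaches k a c = a ≈ c ⊎ DistLE a c k

  Reaches-respˡ : ∀ {k a a′ c} → a′ ≈ a → Reaches k a c → Reaches (suc k) a′ c
  Reaches-respˡ a′≈a (inj₁ a≈c) = inj₁ (≈-trans a′≈a a≈c)
  Reaches-respˡ a′≈a (inj₂ (zero , _ , here _)) = inj₁ a′≈a
  Reaches-respˡ a′≈a (inj₂ (suc j , j≤k , step ab P)) =
    inj₂ (suc j , ℕ.m≤n⇒m≤1+n j≤k , step (Adjacent-respˡ (≈-sym a′≈a) ab) P)

  walk⇒Reaches : ∀ {k a c} → CommWalk k a c → Reaches k a c
  walk⇒Reaches [ _ ] = inj₁ ≈-refl
  walk⇒Reaches {a = a} {c = c} (_∷⟨_⟩_ {b = b} aᵥ ab w) with a ≈? b | walk⇒Reaches w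
  ... | yes a≈b | bc = Reaches-respˡ a≈b bc
  ... | no a≉b | inj₁ b≈c = inj₂ (1 , s≤s z≤n , step a~c (here (walk-last w)))
    where
    a~c : Adjacent a c
    a~c = aᵥ , walk-last w , (λ a≈c → a≉b (≈-trans a≈c (≈-sym b≈c))) , Commute-respʳ b≈c ab
  ... | no a≉b | inj₂ (j , j≤k , P) = inj₂ (suc j , s≤s j≤k , step (aᵥ , walk-head w , a≉b , ab) P)

  walk⇒DistLE : ∀ {k a c} → CommWalk k a c → ¬ a ≈ c → DistLE a c k
  walk⇒DistLE w a≉c with walk⇒Reaches w
  ... | inj₁ a≈c = contradiction a≈c a≉c
  ... | inj₂ d = d

  total : (Fin n → Fin n) → PT n
  total g = just ∘ g

  single : Fin n → Fin n → PT n
  single p q x with x ≟ p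
  ... | yes _ = just q
  ... | no _ = nothing

  redirect : Fin n → Fin n → Fin n → Fin n
  redirect u t x with x ≟ u
  ... | yes _ = t
  ... | no _ = x

  single-≡ : ∀ {p q} → single p q p ≡ just q
  single-≡ {p} with p ≟ p
  ... | yes _ = refl
  ... | no p≢p = contradiction refl p≢p

  single-≢ : ∀ {p q x} → x ≢ p → single p q x ≡ nothing
  single-≢ {p} {x = x} x≢p with x ≟ p
  ... | yes x≡p = contradiction x≡p x≢p
  ... | no _ = refl

  single-image : ∀ {p q r x} → q ≢ r → single p q x ≢ just r
  single-image {p} {x = x} q≢r with x ≟ p
  ... | yes _ = q≢r ∘ Maybe.just-injective
  ... | no _ = λ ()

  single-IsVertex : 1 < n → ∀ p q → IsVertex (single p q)
  single-IsVertex 1<n p q with fresh (p ∷ []) 1<n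
  ... | x , x∉ = partial⇒IsVertex (single-≡ {p} {q}) (single-≢ {p} {q} (x∉ ∘ here))

  redirect-≡ : ∀ {u t} → redirect u t u ≡ t
  redirect-≡ {u} with u ≟ u
  ... | yes _ = refl
  ... | no u≢u = contradiction refl u≢u

  redirect-≢ : ∀ {u t x} → x ≢ u → redirect u t x ≡ x
  redirect-≢ {u} {x = x} x≢u with x ≟ u
  ... | yes x≡u = contradiction x≡u x≢u
  ... | no _ = refl

  redirect-preimage : ∀ {u t p x} → t ≢ p → redirect u t x ≡ p → x ≡ p
  redirect-preimage {u} {x = x} t≢p with x ≟ u
  ... | yes _ = λ t≡p → contradiction t≡p t≢p
  ... | no _ = λ x≡p → x≡p

  total-Commute : ∀ {g h} → (∀ x → h (g x) ≡ g (h x)) → Commute (total g) (total h)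
  total-Commute hg≡gh x = cong just (hg≡gh x)

  single-Commute : ∀ {p q b} → (∀ x → b x ≢ just p) → b q ≡ nothing → Commute (single p q) b
  single-Commute {p} {q} {b} p∉im b⟨q⟩≡∅ = annihilating⇒Commute {single p q} {b} single·b≈∅ b·single≈∅
    where
    single·b≈∅ : (single p q · b) ≈ emptyMap
    single·b≈∅ x with x ≟ p
    ... | yes _ = b⟨q⟩≡∅
    ... | no _ = refl
    b·single≈∅ : (b · single p q) ≈ emptyMap
    b·single≈∅ x with b x in bx
    ... | nothing = refl
    ... | just y = single-≢ λ y≡p → p∉im x (trans bx (cong just y≡p))

  total-Commute-single : ∀ {g p q} → (∀ x → g x ≡ p → x ≡ p) → g p ≡ p → g q ≡ q →
                         Commute (total g) (single p q)
  total-Commute-single {g} {p} {q} g⁻¹p⊆p gp≡p gq≡q x with x ≟ p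
  ... | yes refl = trans (cong (single p q) gp≡p) (trans single-≡ (cong just (sym gq≡q)))
  ... | no x≢p = single-≢ (x≢p ∘ g⁻¹p⊆p x)

  idempotent-Commute-fibre : ∀ {e z w} → (∀ x → e (e x) ≡ e x) → e w ≡ w →
                             Commute (total e) (total e · single z w)
  idempotent-Commute-fibre {e} {z} {w} e-idem ew≡w x rewrite e-idem x with e x ≟ z
  ... | yes _ = cong just (sym ew≡w)
  ... | no _ = refl

  undefinedPoint : (b : PT n) → ¬ IsFull b → ∃ λ q → b q ≡ nothing
  undefinedPoint b b-partial with Fin.¬∀⟶∃¬ n _ defined? b-partial
    where
    defined? : ∀ x → Dec (∃ λ y → b x ≡ just y)
    defined? x with b x
    ... | just y = yes (y , refl)
    ... | nothing = no λ ()
  ... | q , q∉dom with b q in bq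
  ...   | just y = contradiction (y , refl) q∉dom
  ...   | nothing = q , bq

missedPoint : ∀ {n} (b : PT n) {q} → b q ≡ nothing → ∃ λ p → ∀ x → b x ≢ just p
missedPoint {zero} b {()}
missedPoint {suc n} b {q} b⟨q⟩≡∅ with Fin.¬∀⟶∃¬ (suc n) _ image? ¬onto
  where
  image? : ∀ p → Dec (∃ λ x → b x ≡ just p)
  image? p = Fin.any? (λ x → Maybe.≡-dec _≟_ (b x) (just p))
  ¬onto : ¬ (∀ p → ∃ λ x → b x ≡ just p)
  ¬onto onto = Fin.<⇒notInjective (ℕ.n<1+n n) section-injective
    where
    section : Fin (suc n) → Fin (suc n)
    section p = proj₁ (onto p)
    q≢section : ∀ p → q ≢ section p
    q≢section p q≡s with () ← trans (sym b⟨q⟩≡∅) (trans (cong b q≡s) (proj₂ (onto p)))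
    section-injective : ∀ {p p′} → punchOut (q≢section p) ≡ punchOut (q≢section p′) → p ≡ p′
    section-injective {p} {p′} eq = Maybe.just-injective (begin
      just p            ≡⟨ proj₂ (onto p) ⟨
      b (section p)     ≡⟨ cong b (Fin.punchOut-injective (q≢section p) (q≢section p′) eq) ⟩
      b (section p′)    ≡⟨ proj₂ (onto p′) ⟩
      just p′           ∎)
      where open ≡-Reasoning
... | p , p∉im = p , λ x bx≡p → p∉im (x , bx≡p)

module _ {n : ℕ} where
  open Endo (Fin n) using (_^_)

  ^-identity⇒IsPerm : ∀ {a g} K .{{_ : NonZero K}} → a ≈ total g → (∀ x → (g ^ K) x ≡ x) → IsPerm a
  ^-identity⇒IsPerm {a} {g} (suc k) a≈g gᴷ≡id = full , injective , surjective
    where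
    full : IsFull a
    full x = g x , a≈g x
    injective : ∀ x y → a x ≡ a y → x ≡ y
    injective x y ax≡ay = begin
      x             ≡⟨ gᴷ≡id x ⟨
      g ((g ^ k) x) ≡⟨ ^-commute g k 1 x ⟨
      (g ^ k) (g x) ≡⟨ cong (g ^ k) (Maybe.just-injective (trans (sym (a≈g x)) (trans ax≡ay (a≈g y)))) ⟩
      (g ^ k) (g y) ≡⟨ ^-commute g k 1 y ⟩
      g ((g ^ k) y) ≡⟨ gᴷ≡id y ⟩
      y             ∎
      where open ≡-Reasoning
    surjective : ∀ y → ∃ λ x → a x ≡ just y
    surjective y = (g ^ k) y , trans (a≈g _) (cong just (gᴷ≡id y))

  fixedPoint-walk : 4 ≤ n → ∀ {α g f p q γ k} → α ≈ total g → IsVertex α → g f ≡ f →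
                    CommWalk k (single p q) γ → CommWalk (3 + k) α γ
  fixedPoint-walk 4≤n {α} {g} {f} {p} {q} α≈g αᵥ gf≡f walk
    with u , u≢p , u≢q , u≢f ← fresh₃ 4≤n p q f
    with t , t≢p , t≢u , _ ← fresh₃ 4≤n p u u
    = αᵥ ∷⟨ α-Commute-κ ⟩ κᵥ ∷⟨ κ-Commute-σ ⟩ σᵥ ∷⟨ σ-Commute-ν ⟩ walk
    where
    κ σ : PT n
    κ = total (const f)
    σ = total (redirect u t)
    κᵥ : IsVertex κ
    κᵥ = moves⇒IsVertex {x = u} refl u≢f
    σᵥ : IsVertex σ
    σᵥ = moves⇒IsVertex {x = u} (cong just (redirect-≡ {u = u} {t = t})) (t≢u ∘ sym)
    α-Commute-κ : Commute α κ
    α-Commute-κ = Commute-respˡ {b = κ} (≈-sym α≈g) (total-Commute {g = g} {h = const f} (λ _ → sym gf≡f))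
    κ-Commute-σ : Commute κ σ
    κ-Commute-σ = total-Commute {g = const f} {h = redirect u t} (λ _ → redirect-≢ (u≢f ∘ sym))
    σ-Commute-ν : Commute σ (single p q)
    σ-Commute-ν = total-Commute-single (λ _ → redirect-preimage t≢p)
      (redirect-≢ (u≢p ∘ sym)) (redirect-≢ (u≢q ∘ sym))

  fixedPointFree-walk : ∀ {α g p q γ k} → α ≈ total g → IsVertex α → ¬ IsPerm α → (∀ x → g x ≢ x) →
                        CommWalk k (single p q) γ → CommWalk (3 + k) α γ
  fixedPointFree-walk {α} {g} {p} {q} α≈g αᵥ α-nonPerm fixedPointFree walk =
    αᵥ ∷⟨ α-Commute-ε ⟩ εᵥ ∷⟨ ε-Commute-ℓ ⟩ ℓᵥ ∷⟨ ℓ-Commute-ν ⟩ walk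
    where
    e : Fin n → Fin n
    e = g ^ (n !)
    e-idem : ∀ x → e (e x) ≡ e x
    e-idem = ^!-idempotent g
    z : Fin n
    z = g (e q)
    ez≡z : e z ≡ z
    ez≡z = trans (^-commute g (n !) 1 (e q)) (cong g (e-idem q))
    eq≢z : e q ≢ z
    eq≢z = fixedPointFree (e q) ∘ sym
    w-fixed : ∃ λ w → e w ≡ w × w ≢ p
    w-fixed with p ≟ e q
    ... | yes p≡eq = z , ez≡z , λ z≡p → eq≢z (sym (trans z≡p p≡eq))
    ... | no p≢eq = e q , e-idem q , p≢eq ∘ sym
    w : Fin n
    w = proj₁ w-fixed
    ε ℓ : PT n
    ε = total e
    ℓ = ε · single z w
    εᵥ : IsVertex ε
    εᵥ = defined⇒≉∅ {x = q} refl , λ ε≈id →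
      α-nonPerm (^-identity⇒IsPerm (n !) {{n ℕ.!≢0}} α≈g (Maybe.just-injective ∘ ε≈id))
    ℓᵥ : IsVertex ℓ
    ℓᵥ = partial⇒IsVertex {x = z} (trans (cong (single z w) ez≡z) single-≡) (single-≢ eq≢z)
    α-Commute-ε : Commute α ε
    α-Commute-ε = Commute-respˡ {b = ε} (≈-sym α≈g) (total-Commute {g = g} {h = e} (^-commute g (n !) 1))
    ε-Commute-ℓ : Commute ε ℓ
    ε-Commute-ℓ = idempotent-Commute-fibre e-idem (proj₁ (proj₂ w-fixed))
    ℓ-Commute-ν : Commute ℓ (single p q)
    ℓ-Commute-ν = Commute-sym {a = single p q} {b = ℓ}
      (single-Commute (λ x → single-image (proj₂ (proj₂ w-fixed))) (single-≢ eq≢z))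

lemma3p3 : (n : ℕ) → 4 ≤ n → (α β : PT n) →
    IsFull α → ¬ IsPerm α →
    ¬ IsFull β → ¬ (β ≈ emptyMap) →
    DistLE α β 4
lemma3p3 n 4≤n α β α-full α-nonPerm β-partial β≉∅
  with q , β⟨q⟩≡∅ ← undefinedPoint β β-partial
  with p , p∉im ← missedPoint β β⟨q⟩≡∅
  = walk⇒DistLE walk α≉β
  where
  g : Fin n → Fin n
  g x = proj₁ (α-full x)
  α≈g : α ≈ total g
  α≈g x = proj₂ (α-full x)
  α≉β : ¬ α ≈ β
  α≉β α≈β = β-partial λ x → g x , trans (sym (α≈β x)) (α≈g x)
  αᵥ : IsVertex α
  αᵥ = full⇒IsVertex q α-full α-nonPerm
  ν-walk : CommWalk 1 (single p q) β
  ν-walk = single-IsVertex (ℕ.≤-trans (s≤s (s≤s z≤n)) 4≤n) p q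
    ∷⟨ single-Commute p∉im β⟨q⟩≡∅ ⟩
    [ nonFull⇒IsVertex β≉∅ β-partial ]
  walk : CommWalk 4 α β
  walk with Fin.any? (λ f → g f ≟ f)
  ... | yes (f , gf≡f) = fixedPoint-walk 4≤n α≈g αᵥ gf≡f ν-walk
  ... | no no-fixed = fixedPointFree-walk α≈g αᵥ α-nonPerm (λ x gx≡x → no-fixed (x , gx≡x)) ν-walk
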